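{- Let $\mathbf f=f_0f_1f_2\cdots=0100\cdots$ be the Fibonacci word, $f_{t-1}=\lfloor (t+1)\gamma\rfloor-\lfloor t\gamma\rfloor$ ($t\ge1$), $\gamma=(3-\sqrt5)/2$, and let $T(i,m,n)=\sum_{k=0}^{m-1}\sum_{\ell=0}^{n-1}f_{i+k+\ell}$. For every integer $k\ge1$, with $m=n=F_{3k}/2$, the number of distinct values of $T(i,m,n)$, taken over all $i\ge0$, is at least $k+1$.
   Context: Fibonacci numbers: $F_0=0$, $F_1=1$, $F_{t+1}=F_t+F_{t-1}$ (so $F_{3k}$ is even). -}

module Defs where

open import Data.Nat using (ℕ; zero; suc; _+_; _*_; _∸_; _≤ᵇ_)
open import Data.Nat.DivMod using (_/_)
open import Data.Bool using (if_then_else_)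

fib : ℕ → ℕ
fib zero          = 0
fib (suc zero)    = 1
fib (suc (suc t)) = fib (suc t) + fib t

sqrtBelow : ℕ → ℕ → ℕ
sqrtBelow N zero    = 0
sqrtBelow N (suc b) = if suc b * suc b ≤ᵇ N then suc b else sqrtBelow N b

isqrt : ℕ → ℕ
isqrt N = sqrtBelow N N

-- ⌊t γ⌋ with γ = (3 - √5)/2, computed exactly in integers:
-- with a = ⌊t√5⌋ (t√5 irrational for t ≥ 1), ⌊(3t - t√5)/2⌋ = ⌊(3t - a - 1)/2⌋;
-- for t = 0 the formula gives 0 as well.
floorTγ : ℕ → ℕ
floorTγ t = ((3 * t ∸ isqrt (5 * (t * t))) ∸ 1) / 2

-- Fibonacci word: f_{t-1} = ⌊(t+1)γ⌋ - ⌊tγ⌋ (t ≥ 1), i.e. f_j = ⌊(j+2)γ⌋ - ⌊(j+1)γ⌋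
fword : ℕ → ℕ
fword j = floorTγ (suc (suc j)) ∸ floorTγ (suc j)

sumTo : ℕ → (ℕ → ℕ) → ℕ
sumTo zero    g = 0
sumTo (suc m) g = sumTo m g + g m

T : ℕ → ℕ → ℕ → ℕ
T i m n = sumTo m (λ k → sumTo n (λ ℓ → fword (i + k + ℓ)))

-- Write S n = Σ_{x=1}^{n} ⌊xγ⌋ (floorSum).  For even N the fraction F_N / F_{N+2} is so close to γ
-- that ⌊tγ⌋ = ⌊t F_N / F_{N+2}⌋ for t ≤ F_{N+1}; d'Ocagne's identity then controls the residues of
-- t F_N modulo F_{N+2} and yields the carry rule ⌊(x+y)γ⌋ − ⌊xγ⌋ − ⌊yγ⌋ ∈ {0,1} and the shift rule
-- ⌊(y + F_{i+2})γ⌋ = ⌊yγ⌋ + F_i for 0 < y < F_{i+3}.  Telescoping gives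
-- T(i,m,m) = S(i+2m) − 2 S(i+m) + S(i), so by the carry rule i ↦ T(i,m,m) moves by at most 1 per
-- step, while the shift rule gives closed forms for S at Fibonacci numbers and at
-- a_k = (F_{3k+2} − 1)/4.  For m = F_{3k}/2 = a_k − a_{k−1} they give T(a_k,m,m) − T(a_{k−1},m,m) = ±k,
-- so all k + 1 values in between are taken.
module Submission where

open import Defs
open import Data.Nat using (ℕ; zero; suc; _+_; _*_; _∸_; _≤_; _<_; z≤n; s≤s; NonZero; >-nonZero; _≤ᵇ_)
open import Data.Nat.Properties
open import Data.Nat.DivMod
open import Data.Nat.Divisibility using (n∣m*n)
open import Data.Bool using (true; false) renaming (T to True)
open import Data.Unit using (tt)
open import Relation.Nullary using (yes; no; contradiction)
open import Function using (_∘_)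
open import Function.Definitions using (Injective)
open import Data.Fin using (Fin; toℕ)
open import Data.Fin.Properties using (toℕ-injective; toℕ<n)
open import Data.Product using (Σ; _×_; _,_; proj₁; proj₂)
open import Data.Sum using (_⊎_; inj₁; inj₂; [_,_]′)
open import Relation.Binary.Definitions using (tri<; tri≈; tri>)
open import Relation.Binary.PropositionalEquality
  using (_≡_; refl; sym; trans; cong; cong₂; subst; subst₂)
open import Data.Nat.Tactic.RingSolver using (solve-∀; solve)
open import Data.List using (_∷_; [])
open ≤-Reasoning
import Data.Integer as ℤ
import Data.Integer.Properties as ℤₚ
import Data.Integer.Tactic.RingSolver as ℤ-Ring

ByParity : ℕ → Set → Set → Set
ByParity zero    A B = A
ByParity (suc n) A B = ByParity n B A

ByParity-map : ∀ n {A A′ B B′ : Set} → (A → A′) → (B → B′) → ByParity n A B → ByParity n A′ B′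
ByParity-map zero    f g = f
ByParity-map (suc n) f g = ByParity-map n g f

ByParity-zipWith : ∀ n {A A′ A″ B B′ B″ : Set} →
  (A → A′ → A″) → (B → B′ → B″) → ByParity n A B → ByParity n A′ B′ → ByParity n A″ B″
ByParity-zipWith zero    f g = f
ByParity-zipWith (suc n) f g = ByParity-zipWith n g f

ByParity-elim : ∀ n {A B C : Set} → (A → C) → (B → C) → ByParity n A B → C
ByParity-elim zero    f g = f
ByParity-elim (suc n) f g = ByParity-elim n g f

ByParity-even : ∀ n {A B : Set} → ByParity (n + n) A B → A
ByParity-even zero    a = a
ByParity-even (suc n) a rewrite +-suc n n = ByParity-even n a

-- A − B = (−1)ⁿ C, stated without subtraction.
SignedDiff : ℕ → ℕ → ℕ → ℕ → Set
SignedDiff n A B C = ByParity n (A ≡ B + C) (A + C ≡ B)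

SignedDiff-suc : ∀ n {A B A′ B′ C} → A′ + A ≡ B′ + B → SignedDiff n A B C → SignedDiff (suc n) A′ B′ C
SignedDiff-suc n {A} {B} {A′} {B′} {C} e = ByParity-map n even odd
  where
  even : A ≡ B + C → A′ + C ≡ B′
  even refl = +-cancelʳ-≡ B _ _ (trans (regroup A′ B C) e)
    where
    regroup : ∀ a b c → a + c + b ≡ a + (b + c)
    regroup = solve-∀
  odd : A + C ≡ B → A′ ≡ B′ + C
  odd refl = +-cancelʳ-≡ A _ _ (trans e (regroup B′ A C))
    where
    regroup : ∀ b a c → b + (a + c) ≡ b + c + a
    regroup = solve-∀

fib-pos : ∀ n → 1 ≤ fib (suc n)
fib-pos zero    = s≤s z≤n
fib-pos (suc n) = ≤-trans (fib-pos n) (m≤m+n (fib (suc n)) (fib n))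

fib-≤-suc : ∀ n → fib n ≤ fib (suc n)
fib-≤-suc zero    = z≤n
fib-≤-suc (suc n) = m≤m+n (fib (suc n)) (fib n)

fib-mono : ∀ {m n} → m ≤ n → fib m ≤ fib n
fib-mono {m} {n} m≤n with m≤n⇒∃[o]m+o≡n m≤n
... | o , refl = go o
  where
  go : ∀ o → fib m ≤ fib (m + o)
  go zero    = ≤-reflexive (cong fib (sym (+-identityʳ m)))
  go (suc o) = ≤-trans (go o) (subst (fib (m + o) ≤_) (cong fib (sym (+-suc m o))) (fib-≤-suc (m + o)))

fib-<-suc : ∀ n → fib (2 + n) < fib (3 + n)
fib-<-suc n = subst (_≤ fib (3 + n)) (+-comm (fib (2 + n)) 1) (+-monoʳ-≤ (fib (2 + n)) (fib-pos n))

fib-double : ∀ n → fib n + fib n ≤ fib (2 + n)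
fib-double n = subst (fib n + fib n ≤_) (+-comm (fib n) (fib (suc n))) (+-monoʳ-≤ (fib n) (fib-≤-suc n))

fib-double-< : ∀ n → fib (2 + n) + fib (2 + n) < fib (4 + n)
fib-double-< n = subst (fib (2 + n) + fib (2 + n) <_) (+-comm (fib (2 + n)) (fib (3 + n)))
  (+-monoʳ-< (fib (2 + n)) (fib-<-suc n))

index<fib : ∀ n → n < fib (2 + n)
index<fib zero    = s≤s z≤n
index<fib (suc n) = subst (_≤ fib (3 + n)) (+-comm (suc n) 1) (+-mono-≤ (index<fib n) (fib-pos n))

ocagne : ∀ i c → SignedDiff i (fib (2 + i) * fib (i + c)) (fib i * fib (2 + i + c)) (fib c)
ocagne zero    c = +-identityʳ (fib c)
ocagne (suc i) c =
  SignedDiff-suc i (identity (fib i) (fib (suc i)) (fib (i + c)) (fib (suc (i + c)))) (ocagne i c)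
  where
  identity : ∀ x y u v → (y + x + y) * v + (y + x) * u ≡ y * (v + u + v) + x * (v + u)
  identity = solve-∀

module _ {Q : ℕ} .{{_ : NonZero Q}} where

  %-unique : ∀ {a q r} → a ≡ r + q * Q → r < Q → a % Q ≡ r
  %-unique {q = q} {r} refl r<Q = trans ([m+kn]%n≡m%n r q Q) (m<n⇒m%n≡m r<Q)

  /-unique : ∀ {a q r} → a ≡ r + q * Q → r < Q → a / Q ≡ q
  /-unique {q = q} {r} refl r<Q = begin-equality
    (r + q * Q) / Q     ≡⟨ +-distrib-/-∣ʳ r (n∣m*n q) ⟩
    r / Q + q * Q / Q   ≡⟨ cong₂ _+_ (m<n⇒m/n≡0 r<Q) (m*n/n≡m q Q) ⟩
    q                   ∎

  /-+-carry : ∀ a b → Σ ℕ λ e → e ≤ 1 × (a + b) / Q ≡ a / Q + b / Q + e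
  /-+-carry a b = e , ≤-pred (m<n*o⇒m/o<n {n = 2} remainders<2Q) , (begin-equality
    (a + b) / Q                                   ≡⟨ /-congˡ (cong₂ _+_ (m≡m%n+[m/n]*n a Q) (m≡m%n+[m/n]*n b Q)) ⟩
    (a % Q + a / Q * Q + (b % Q + b / Q * Q)) / Q ≡⟨ /-congˡ (regroup (a % Q) (b % Q) (a / Q) (b / Q) Q) ⟩
    (a % Q + b % Q + (a / Q + b / Q) * Q) / Q     ≡⟨ +-distrib-/-∣ʳ (a % Q + b % Q) (n∣m*n (a / Q + b / Q)) ⟩
    e + (a / Q + b / Q) * Q / Q                   ≡⟨ cong (e +_) (m*n/n≡m (a / Q + b / Q) Q) ⟩
    e + (a / Q + b / Q)                           ≡⟨ +-comm e _ ⟩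
    a / Q + b / Q + e                             ∎)
    where
    e : ℕ
    e = (a % Q + b % Q) / Q
    remainders<2Q : a % Q + b % Q < 2 * Q
    remainders<2Q = subst (a % Q + b % Q <_) (cong (Q +_) (sym (+-identityʳ Q)))
      (+-mono-< (m%n<n a Q) (m%n<n b Q))
    regroup : ∀ x y u v Q → x + u * Q + (y + v * Q) ≡ x + y + (u + v) * Q
    regroup = solve-∀

m*m<n*n⇒m<n : ∀ {m n} → m * m < n * n → m < n
m*m<n*n⇒m<n {m} {n} lt with m <? n
... | yes m<n = m<n
... | no m≮n  = contradiction lt (≤⇒≯ (*-mono-≤ (≮⇒≥ m≮n) (≮⇒≥ m≮n)))

m*m≤n*n⇒m≤n : ∀ {m n} → m * m ≤ n * n → m ≤ n
m*m≤n*n⇒m≤n {m} {n} le = ≤-pred (m*m<n*n⇒m<n (≤-<-trans le (*-mono-< (n<1+n n) (n<1+n n))))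

sqrtBelow-spec : ∀ N b → N < suc b * suc b →
  sqrtBelow N b * sqrtBelow N b ≤ N × N < suc (sqrtBelow N b) * suc (sqrtBelow N b)
sqrtBelow-spec N zero    N<1 = z≤n , N<1
sqrtBelow-spec N (suc b) N<b² with suc b * suc b ≤ᵇ N in eq
... | true  = ≤ᵇ⇒≤ (suc b * suc b) N (subst True (sym eq) tt) , N<b²
... | false = sqrtBelow-spec N b (≰⇒> (λ le → subst True eq (≤⇒≤ᵇ le)))

isqrt-spec : ∀ N → isqrt N * isqrt N ≤ N × N < suc (isqrt N) * suc (isqrt N)
isqrt-spec N = sqrtBelow-spec N N (s≤s (m≤m+n N (N * suc N)))

isqrt-≥ : ∀ {N v} → v * v ≤ N → v ≤ isqrt N
isqrt-≥ {N} v²≤N = ≤-pred (m*m<n*n⇒m<n (≤-<-trans v²≤N (proj₂ (isqrt-spec N))))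

isqrt-< : ∀ {N u} → N < u * u → isqrt N < u
isqrt-< {N} N<u² = m*m<n*n⇒m<n (≤-<-trans (proj₁ (isqrt-spec N)) N<u²)

floorTγ-from-squares : ∀ t q v → 2 + (q + q) + v ≡ 3 * t →
  v * v ≤ 5 * (t * t) → 5 * (t * t) < (2 + v) * (2 + v) → floorTγ t ≡ q
floorTγ-from-squares t q v 3t≡ v²≤5t² 5t²<u² with m≤n⇒∃[o]m+o≡n (isqrt-≥ v²≤5t²)
... | d , v+d≡a = begin-equality
  floorTγ t                               ≡⟨ cong (λ x → ((x ∸ a) ∸ 1) / 2) (sym 3t≡) ⟩
  ((2 + (q + q) + v ∸ a) ∸ 1) / 2         ≡⟨ cong (λ x → ((x ∸ a) ∸ 1) / 2) (+-comm (2 + (q + q)) v) ⟩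
  ((v + (2 + (q + q)) ∸ a) ∸ 1) / 2       ≡⟨ cong (λ x → ((v + (2 + (q + q)) ∸ x) ∸ 1) / 2) (sym v+d≡a) ⟩
  ((v + (2 + (q + q)) ∸ (v + d)) ∸ 1) / 2 ≡⟨ cong (λ x → (x ∸ 1) / 2) ([m+n]∸[m+o]≡n∸o v _ d) ⟩
  ((2 + (q + q) ∸ d) ∸ 1) / 2             ≡⟨ halve d d<2 ⟩
  q                                       ∎
  where
  a = isqrt (5 * (t * t))
  d<2 : d < 2
  d<2 = +-cancelˡ-< v d 2 (subst₂ _<_ (sym v+d≡a) (+-comm 2 v) (isqrt-< 5t²<u²))
  double : ∀ e q → e + (q + q) ≡ e + q * 2
  double = solve-∀
  halve : ∀ d → d < 2 → ((2 + (q + q) ∸ d) ∸ 1) / 2 ≡ q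
  halve 0 _ = /-unique (double 1 q) (s≤s (s≤s z≤n))
  halve 1 _ = /-unique (double 0 q) (s≤s z≤n)
  halve (suc (suc _)) (s≤s (s≤s ()))

cassini : ∀ n → SignedDiff n (fib (1 + n) * fib (1 + n)) (fib n * fib (2 + n)) 1
cassini zero    = refl
cassini (suc n) = SignedDiff-suc n (identity (fib n) (fib (suc n))) (cassini n)
  where
  identity : ∀ x y → (y + x) * (y + x) + y * y ≡ y * (y + x + y) + x * (y + x)
  identity = solve-∀

nothing-below-1 : ∀ {A : ℕ → Set} y → 0 < y → y < 1 → A y
nothing-below-1 (suc _) _ (s≤s ())

-- F_N / F_{N+2} is a convergent of γ.
module Convergent (N : ℕ) where

  P Q : ℕ
  P = fib N
  Q = fib (2 + N)

  instance
    Q-nonZero : NonZero Q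
    Q-nonZero = >-nonZero (≤-trans (fib-pos N) (m≤m+n (fib (suc N)) (fib N)))

  res quo : ℕ → ℕ
  res y = y * P % Q
  quo y = y * P / Q

  division : ∀ y → y * P ≡ res y + quo y * Q
  division y = m≡m%n+[m/n]*n (y * P) Q

  ocagne-PQ : ∀ i c → i + c ≡ N → SignedDiff i (fib (2 + i) * P) (fib i * Q) (fib c)
  ocagne-PQ i c refl = ocagne i c

  Margins : ℕ → ℕ → ℕ → Set
  Margins lo hi r = lo ≤ r × r + hi ≤ Q

  -- The residue keeps a distance C from 0 and from Q, strictly on the side
  -- towards which adding F_{i+2} moves it.
  ResidueBound : ℕ → ℕ → ℕ → Set
  ResidueBound i C r = ByParity i (Margins C (suc C) r) (Margins (suc C) C r)

  Margins-weaken : ∀ {lo lo′ hi hi′ r} → lo′ ≤ lo → hi′ ≤ hi → Margins lo hi r → Margins lo′ hi′ r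
  Margins-weaken lo′≤lo hi′≤hi (lo≤r , r+hi≤Q) =
    ≤-trans lo′≤lo lo≤r , ≤-trans (+-monoʳ-≤ _ hi′≤hi) r+hi≤Q

  ResidueBound-mono : ∀ i {C C′ r} → C ≤ C′ → ResidueBound i C′ r → ResidueBound i C r
  ResidueBound-mono i C≤C′ =
    ByParity-map i (Margins-weaken C≤C′ (s≤s C≤C′)) (Margins-weaken (s≤s C≤C′) C≤C′)

  ResidueBound-pred : ∀ i {C C′ r} → C < C′ → ResidueBound i C′ r → ResidueBound (suc i) C r
  ResidueBound-pred i C<C′ = ByParity-map i (Margins-weaken C<C′ C≤1+C′) (Margins-weaken C≤1+C′ C<C′)
    where C≤1+C′ = ≤-trans (<⇒≤ C<C′) (n≤1+n _)

  ResidueBound-shift : ∀ i {C C′ r r′} → C + C ≤ C′ → ResidueBound i C′ r → SignedDiff i r′ r C →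
                       ResidueBound i C r′
  ResidueBound-shift i {C} {C′} {r} 2C≤C′ = ByParity-zipWith i up down
    where
    up : ∀ {r′} → Margins C′ (suc C′) r → r′ ≡ r + C → Margins C (suc C) r′
    up (_ , r+C′<Q) refl = m≤n+m C r , ≤-trans (≤-reflexive (+-assoc r C (suc C)))
      (≤-trans (+-monoʳ-≤ r (subst (_≤ suc C′) (sym (+-suc C C)) (s≤s 2C≤C′))) r+C′<Q)
    down : ∀ {r′} → Margins (suc C′) C′ r → r′ + C ≡ r → Margins (suc C) C r′
    down (C′<r , r+C′≤Q) refl =
      +-cancelʳ-≤ C (suc C) _ (≤-trans (s≤s 2C≤C′) C′<r) , ≤-trans (m≤m+n _ C′) r+C′≤Q

  division-shift : ∀ i {J F C} z → SignedDiff i (J * P) (F * Q) C → ResidueBound i C (res z) →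
          ByParity i (res (z + J) ≡ res z + C × quo (z + J) ≡ quo z + F)
                     (res (z + J) + C ≡ res z × quo (z + J) ≡ quo z + F)
  division-shift i {J} {F} {C} z = ByParity-zipWith i up down
    where
    up : J * P ≡ F * Q + C → Margins C (suc C) (res z) →
         res (z + J) ≡ res z + C × quo (z + J) ≡ quo z + F
    up JP≡ (_ , r+C<Q) = %-unique {q = quo z + F} split r+C<Q′ , /-unique split r+C<Q′
      where
      r+C<Q′ : res z + C < Q
      r+C<Q′ = ≤-trans (≤-reflexive (sym (+-suc (res z) C))) r+C<Q
      regroup : ∀ r q Q F C → r + q * Q + (F * Q + C) ≡ r + C + (q + F) * Q
      regroup = solve-∀
      split : (z + J) * P ≡ res z + C + (quo z + F) * Q
      split = begin-equality
        (z + J) * P                          ≡⟨ *-distribʳ-+ P z J ⟩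
        z * P + J * P                        ≡⟨ cong₂ _+_ (division z) JP≡ ⟩
        res z + quo z * Q + (F * Q + C)      ≡⟨ regroup (res z) (quo z) Q F C ⟩
        res z + C + (quo z + F) * Q          ∎
    down : J * P + C ≡ F * Q → Margins (suc C) C (res z) →
           res (z + J) + C ≡ res z × quo (z + J) ≡ quo z + F
    down JP+C≡ (C<r , _) =
      trans (cong (_+ C) (%-unique {q = quo z + F} split r′<Q)) r′+C≡r , /-unique split r′<Q
      where
      r′ : ℕ
      r′ = res z ∸ C
      r′+C≡r : r′ + C ≡ res z
      r′+C≡r = m∸n+n≡m (<⇒≤ C<r)
      r′<Q : r′ < Q
      r′<Q = ≤-<-trans (m∸n≤m (res z) C) (m%n<n (z * P) Q)
      regroup₁ : ∀ z J P C → (z + J) * P + C ≡ z * P + (J * P + C)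
      regroup₁ = solve-∀
      regroup₂ : ∀ r C q Q F → r + C + q * Q + F * Q ≡ r + (q + F) * Q + C
      regroup₂ = solve-∀
      split : (z + J) * P ≡ r′ + (quo z + F) * Q
      split = +-cancelʳ-≡ C _ _ (begin-equality
        (z + J) * P + C                      ≡⟨ regroup₁ z J P C ⟩
        z * P + (J * P + C)                  ≡⟨ cong₂ _+_ (division z) JP+C≡ ⟩
        res z + quo z * Q + F * Q            ≡⟨ cong (λ r → r + quo z * Q + F * Q) (sym r′+C≡r) ⟩
        r′ + C + quo z * Q + F * Q           ≡⟨ regroup₂ r′ C (quo z) Q F ⟩
        r′ + (quo z + F) * Q + C             ∎)

  residue-at-J : ∀ i c → i + (2 + c) ≡ N → ResidueBound i (fib (2 + c)) (res (fib (2 + i)))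
  residue-at-J i c refl = ByParity-map i even (odd {fib i}) (ocagne-PQ i (2 + c) refl)
    where
    J C : ℕ
    J = fib (2 + i)
    C = fib (2 + c)
    2C<Q : suc (C + C) ≤ Q
    2C<Q = ≤-trans (fib-double-< c) (fib-mono (s≤s (s≤s (m≤n+m (2 + c) i))))
    C<Q : C < Q
    C<Q = ≤-<-trans (m≤m+n C C) 2C<Q
    even : J * P ≡ fib i * Q + C → Margins C (suc C) (res J)
    even JP≡ = ≤-reflexive (sym r≡C) ,
      subst (λ r → r + suc C ≤ Q) (sym r≡C) (subst (_≤ Q) (sym (+-suc C C)) 2C<Q)
      where
      r≡C : res J ≡ C
      r≡C = %-unique {q = fib i} (trans JP≡ (+-comm _ C)) C<Q
    odd : ∀ {F} → J * P + C ≡ F * Q → Margins (suc C) C (res J)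
    odd {zero} JP+C≡ = contradiction (subst (1 ≤_) (m+n≡0⇒n≡0 (J * P) JP+C≡) (fib-pos (suc c))) λ ()
    odd {suc F} JP+C≡ with m≤n⇒∃[o]m+o≡n (<⇒≤ C<Q)
    ... | r , C+r≡Q =
      +-cancelʳ-≤ C (suc C) (res J)
        (subst (λ x → suc (C + C) ≤ x + C) (sym res≡r) (subst (suc (C + C) ≤_) (sym r+C≡Q) 2C<Q))
      , ≤-reflexive (trans (cong (_+ C) res≡r) r+C≡Q)
      where
      r+C≡Q : r + C ≡ Q
      r+C≡Q = trans (+-comm r C) C+r≡Q
      regroup : ∀ r C F Q → r + C + F * Q ≡ r + F * Q + C
      regroup = solve-∀
      JP≡ : J * P ≡ r + F * Q
      JP≡ = +-cancelʳ-≡ C _ _ (trans JP+C≡ (trans (cong (_+ F * Q) (sym r+C≡Q)) (regroup r C F Q)))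
      res≡r : res J ≡ r
      res≡r = %-unique {q = F} JP≡ (subst (r <_) r+C≡Q (m<m+n r (fib-pos (suc c))))

  residue-bound-step : ∀ i c → i + (2 + c) ≡ N →
    (∀ y → 0 < y → y < fib (2 + i) → ResidueBound (suc i) (fib (3 + c)) (res y)) →
    (∀ z → 0 < z → z < fib (1 + i) → ResidueBound i (fib (4 + c)) (res z)) →
    ∀ y → 0 < y → y < fib (3 + i) → ResidueBound i (fib (2 + c)) (res y)
  residue-bound-step i c e below above y 0<y y<F with <-cmp y (fib (2 + i))
  ... | tri< y<J _ _ = ResidueBound-pred (suc i) (fib-<-suc c) (below y 0<y y<J)
  ... | tri≈ _ refl _ = residue-at-J i c e
  ... | tri> _ _ J<y = subst (λ x → ResidueBound i (fib (2 + c)) (res x)) z+J≡y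
        (ResidueBound-shift i (fib-double (2 + c)) (above z 0<z z<F) residues)
    where
    J z : ℕ
    J = fib (2 + i)
    z = y ∸ J
    z+J≡y : z + J ≡ y
    z+J≡y = m∸n+n≡m (<⇒≤ J<y)
    0<z : 0 < z
    0<z = m<n⇒0<n∸m J<y
    z<F : z < fib (1 + i)
    z<F = +-cancelʳ-< J z (fib (1 + i)) (subst (_< fib (1 + i) + J) (sym z+J≡y)
            (subst (y <_) (+-comm J (fib (1 + i))) y<F))
    residues : SignedDiff i (res (z + J)) (res z) (fib (2 + c))
    residues = ByParity-map i proj₁ proj₁ (division-shift i {F = fib i} z (ocagne-PQ i (2 + c) e)
      (ResidueBound-mono i (fib-mono (≤-trans (n≤1+n (2 + c)) (n≤1+n (3 + c)))) (above z 0<z z<F)))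

  residue-bound : ∀ i c → i + (2 + c) ≡ N →
    ∀ y → 0 < y → y < fib (3 + i) → ResidueBound i (fib (2 + c)) (res y)
  residue-bound zero          c e = residue-bound-step 0 c e nothing-below-1 nothing-below-1
  residue-bound (suc zero)    c e = residue-bound-step 1 c e (residue-bound 0 (suc c) e) nothing-below-1
  residue-bound (suc (suc i)) c e = residue-bound-step (2 + i) c e
    (residue-bound (suc i) (suc c) (trans (+-suc (suc i) (2 + c)) e))
    (residue-bound i (2 + c) (trans (+-suc i (3 + c)) (trans (cong suc (+-suc i (2 + c))) e)))

  quo-shift : ∀ i c → i + (2 + c) ≡ N →
    ∀ y → 0 < y → y < fib (3 + i) → quo (y + fib (2 + i)) ≡ quo y + fib i
  quo-shift i c e y 0<y y<F =
    ByParity-elim i proj₂ proj₂ (division-shift i {F = fib i} y (ocagne-PQ i (2 + c) e) (residue-bound i c e y 0<y y<F))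

  quo-carry : ∀ x y → Σ ℕ λ e → e ≤ 1 × quo (x + y) ≡ quo x + quo y + e
  quo-carry x y = subst (λ a → Σ ℕ λ e → e ≤ 1 × a / Q ≡ quo x + quo y + e)
    (sym (*-distribʳ-+ P x y)) (/-+-carry (x * P) (y * P))

pell : ∀ {P R} → R * R ≡ P * (R + P) + 1 →
  (R + P + (R + R)) * (R + P + (R + R)) ≡ 5 * ((R + P) * (R + P)) + 4
pell {P} {R} cassini′ = +-cancelʳ-≡ (4 * (R * R)) _ _ (begin-equality
  L * L + 4 * (R * R)                  ≡⟨ cong (λ x → L * L + 4 * x) cassini′ ⟩
  L * L + 4 * (P * (R + P) + 1)        ≡⟨ identity P R ⟩
  5 * ((R + P) * (R + P)) + 4 + 4 * (R * R) ∎)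
  where
  L : ℕ
  L = R + P + (R + R)
  identity : ∀ P R → (R + P + (R + R)) * (R + P + (R + R)) + 4 * (P * (R + P) + 1)
                   ≡ 5 * ((R + P) * (R + P)) + 4 + 4 * (R * R)
  identity = solve-∀

pell-scaled : ∀ {L Q} t → L * L ≡ 5 * (Q * Q) + 4 →
  (t * L) * (t * L) ≡ 5 * ((t * Q) * (t * Q)) + 4 * (t * t)
pell-scaled {L} {Q} t pell′ = begin-equality
  (t * L) * (t * L)                       ≡⟨ regroup t L ⟩
  (t * t) * (L * L)                       ≡⟨ cong ((t * t) *_) pell′ ⟩
  (t * t) * (5 * (Q * Q) + 4)             ≡⟨ expand t Q ⟩
  5 * ((t * Q) * (t * Q)) + 4 * (t * t)   ∎
  where
  regroup : ∀ t L → (t * L) * (t * L) ≡ (t * t) * (L * L)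
  regroup = solve-∀
  expand : ∀ t Q → (t * t) * (5 * (Q * Q) + 4) ≡ 5 * ((t * Q) * (t * Q)) + 4 * (t * t)
  expand = solve-∀

-- By the Pell identity, (tL − 2s)² = 5 (tQ)² + 4 (t² + s² − s t L).
square-below : ∀ {L Q t s W} → L * L ≡ 5 * (Q * Q) + 4 → s + s + W ≡ t * L →
  t * t + s * s ≤ s * (t * L) → W * W ≤ 5 * ((t * Q) * (t * Q))
square-below {L} {Q} {t} {s} {W} pell′ 2s+W≡tL t²+s²≤stL = +-cancelʳ-≤ (4 * s * (t * L)) _ _ (begin
  W * W + 4 * s * (t * L)                              ≡⟨ cong (λ x → W * W + 4 * s * x) (sym 2s+W≡tL) ⟩
  W * W + 4 * s * (s + s + W)                          ≡⟨ complete-square W s ⟩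
  (s + s + W) * (s + s + W) + 4 * (s * s)              ≡⟨ cong (λ x → x * x + 4 * (s * s)) 2s+W≡tL ⟩
  (t * L) * (t * L) + 4 * (s * s)                      ≡⟨ cong (_+ 4 * (s * s)) (pell-scaled t pell′) ⟩
  5 * ((t * Q) * (t * Q)) + 4 * (t * t) + 4 * (s * s)  ≡⟨ regroup (5 * ((t * Q) * (t * Q))) (t * t) (s * s) ⟩
  5 * ((t * Q) * (t * Q)) + 4 * (t * t + s * s)        ≤⟨ +-monoʳ-≤ (5 * ((t * Q) * (t * Q))) (*-monoʳ-≤ 4 t²+s²≤stL) ⟩
  5 * ((t * Q) * (t * Q)) + 4 * (s * (t * L))          ≡⟨ cong (5 * ((t * Q) * (t * Q)) +_) (sym (*-assoc 4 s (t * L))) ⟩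
  5 * ((t * Q) * (t * Q)) + 4 * s * (t * L)            ∎)
  where
  complete-square : ∀ W s → W * W + 4 * s * (s + s + W) ≡ (s + s + W) * (s + s + W) + 4 * (s * s)
  complete-square = solve-∀
  regroup : ∀ a x y → a + 4 * x + 4 * y ≡ a + 4 * (x + y)
  regroup = solve-∀

square-above : ∀ {L Q} t → L * L ≡ 5 * (Q * Q) + 4 → 0 < t → 5 * ((t * Q) * (t * Q)) < (t * L) * (t * L)
square-above {L} {Q} t pell′ 0<t = subst (5 * ((t * Q) * (t * Q)) <_) (sym (pell-scaled t pell′))
  (m<m+n _ (*-mono-≤ {1} {4} (s≤s z≤n) (*-mono-≤ 0<t 0<t)))

floorTγ-from-scaled-squares : ∀ Q .{{_ : NonZero Q}} t q v → 2 + (q + q) + v ≡ 3 * t →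
  (Q * v) * (Q * v) ≤ 5 * ((t * Q) * (t * Q)) → 5 * ((t * Q) * (t * Q)) < (Q * (2 + v)) * (Q * (2 + v)) →
  floorTγ t ≡ q
floorTγ-from-scaled-squares Q t q v 3t≡ lower upper = floorTγ-from-squares t q v 3t≡
  (*-cancelˡ-≤ (Q * Q) {{Q²-nonZero}} (subst₂ _≤_ (square Q v) (scale Q t) lower))
  (*-cancelˡ-< (Q * Q) _ _ (subst₂ _<_ (scale Q t) (square Q (2 + v)) upper))
  where
  Q²-nonZero : NonZero (Q * Q)
  Q²-nonZero = m*n≢0 Q Q
  square : ∀ Q x → (Q * x) * (Q * x) ≡ (Q * Q) * (x * x)
  square = solve-∀
  scale : ∀ Q t → 5 * ((t * Q) * (t * Q)) ≡ (Q * Q) * (5 * (t * t))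
  scale = solve-∀

t²+s²≤stL : ∀ {Q R t s} → 0 < t → 0 < s → t ≤ R → s ≤ Q → t * t + s * s ≤ s * (t * (Q + (R + R)))
t²+s²≤stL {Q} {R} {t} {s} 0<t 0<s t≤R s≤Q = begin
  t * t + s * s                       ≤⟨ +-monoˡ-≤ (s * s) (*-monoʳ-≤ t (≤-trans t≤R (m≤m+n R R))) ⟩
  t * (R + R) + s * s                 ≤⟨ +-mono-≤ (m≤n*m (t * (R + R)) s {{>-nonZero 0<s}})
                                                   (*-monoʳ-≤ s (≤-trans s≤Q (m≤n*m Q t {{>-nonZero 0<t}}))) ⟩
  s * (t * (R + R)) + s * (t * Q)     ≡⟨ identity s t Q R ⟩
  s * (t * (Q + (R + R)))             ∎
  where
  identity : ∀ s t Q R → s * (t * (R + R)) + s * (t * Q) ≡ s * (t * (Q + (R + R)))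
  identity = solve-∀

-- With L = Q + 2R and Q = R + P we have 3Q = L + 2P, so tP = r + qQ turns into Q·3t = tL + 2r + 2qQ.
floorTγ-convergent : ∀ {P R} → R * R ≡ P * (R + P) + 1 → ∀ {t q r} → 0 < t → t ≤ R →
  t * P ≡ r + q * (R + P) → r < R + P → floorTγ t ≡ q
floorTγ-convergent {P} {R} cassini′ {t} {q} {r} 0<t t≤R tP≡ r<Q = floorTγ-from-scaled-squares Q t q v 2+2q+v≡3t
  (subst (λ x → x * x ≤ 5 * ((t * Q) * (t * Q))) (sym Qv≡W) (square-below {L} {Q} {t} {s} {W} pell′ 2s+W≡tL
    (t²+s²≤stL 0<t (m<n⇒0<n∸m r<Q) t≤R (m∸n≤m Q r))))
  (subst (λ x → 5 * ((t * Q) * (t * Q)) < x * x) (sym Q[2+v]≡2r+tL)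
    (<-≤-trans (square-above {L} {Q} t pell′ 0<t) (*-mono-≤ (m≤n+m (t * L) (2 * r)) (m≤n+m (t * L) (2 * r)))))
  where
  Q L : ℕ
  Q = R + P
  L = Q + (R + R)
  instance
    Q-nonZero : NonZero Q
    Q-nonZero = >-nonZero (≤-<-trans z≤n r<Q)
  pell′ : L * L ≡ 5 * (Q * Q) + 4
  pell′ = pell {P} {R} cassini′
  P≤R : P ≤ R
  P≤R = m*m≤n*n⇒m≤n (≤-trans (*-monoʳ-≤ P (m≤n+m P R)) (≤-trans (n≤1+n _)
          (≤-reflexive (trans (+-comm 1 _) (sym cassini′)))))
  s : ℕ
  s = Q ∸ r
  r+s≡Q : r + s ≡ Q
  r+s≡Q = m+[n∸m]≡n (<⇒≤ r<Q)
  2s≤tL : s + s ≤ t * L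
  2s≤tL = ≤-trans (+-mono-≤ (m∸n≤m Q r) (≤-trans (m∸n≤m Q r) (+-monoʳ-≤ R P≤R)))
                  (m≤n*m L t {{>-nonZero 0<t}})
  W : ℕ
  W = t * L ∸ (s + s)
  2s+W≡tL : s + s + W ≡ t * L
  2s+W≡tL = m+[n∸m]≡n 2s≤tL
  2r+tL≡Q[2+W] : 2 * r + t * L ≡ Q * 2 + W
  2r+tL≡Q[2+W] = begin-equality
    2 * r + t * L               ≡⟨ cong (2 * r +_) (sym 2s+W≡tL) ⟩
    2 * r + (s + s + W)         ≡⟨ identity r s W ⟩
    2 * (r + s) + W             ≡⟨ cong (λ x → 2 * x + W) r+s≡Q ⟩
    2 * Q + W                   ≡⟨ cong (_+ W) (*-comm 2 Q) ⟩
    Q * 2 + W                   ∎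
    where
    identity : ∀ r s W → 2 * r + (s + s + W) ≡ 2 * (r + s) + W
    identity = solve-∀
  3tQ : Q * (3 * t) ≡ Q * (2 + (q + q)) + W
  3tQ = begin-equality
    Q * (3 * t)                 ≡⟨ identity₁ t P R ⟩
    2 * (t * P) + t * L         ≡⟨ cong (λ x → 2 * x + t * L) tP≡ ⟩
    2 * (r + q * Q) + t * L     ≡⟨ identity₂ r q Q (t * L) ⟩
    Q * (q + q) + (2 * r + t * L) ≡⟨ cong (Q * (q + q) +_) 2r+tL≡Q[2+W] ⟩
    Q * (q + q) + (Q * 2 + W)   ≡⟨ identity₃ Q q W ⟩
    Q * (2 + (q + q)) + W       ∎
    where
    identity₁ : ∀ t P R → (R + P) * (3 * t) ≡ 2 * (t * P) + t * (R + P + (R + R))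
    identity₁ = solve-∀
    identity₂ : ∀ r q Q x → 2 * (r + q * Q) + x ≡ Q * (q + q) + (2 * r + x)
    identity₂ = solve-∀
    identity₃ : ∀ Q q W → Q * (q + q) + (Q * 2 + W) ≡ Q * (2 + (q + q)) + W
    identity₃ = solve-∀
  v : ℕ
  v = 3 * t ∸ (2 + (q + q))
  2+2q+v≡3t : 2 + (q + q) + v ≡ 3 * t
  2+2q+v≡3t = m+[n∸m]≡n (*-cancelˡ-≤ Q (≤-trans (m≤m+n _ W) (≤-reflexive (sym 3tQ))))
  Qv≡W : Q * v ≡ W
  Qv≡W = +-cancelˡ-≡ (Q * (2 + (q + q))) _ _
           (trans (sym (*-distribˡ-+ Q (2 + (q + q)) v)) (trans (cong (Q *_) 2+2q+v≡3t) 3tQ))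
  Q[2+v]≡2r+tL : Q * (2 + v) ≡ 2 * r + t * L
  Q[2+v]≡2r+tL = trans (*-distribˡ-+ Q 2 v) (trans (cong (Q * 2 +_) Qv≡W) (sym 2r+tL≡Q[2+W]))

floorTγ≡quo : ∀ n t → t ≤ fib (1 + (n + n)) → floorTγ t ≡ Convergent.quo (n + n) t
floorTγ≡quo n zero    _   = sym (0/n≡0 Q)
  where open Convergent (n + n)
floorTγ≡quo n (suc t) t≤R = floorTγ-convergent (ByParity-even n (cassini (n + n))) (s≤s z≤n) t≤R
  (division (suc t)) (m%n<n (suc t * P) Q)
  where open Convergent (n + n)

floorTγ-shift : ∀ i y → 0 < y → y < fib (3 + i) → floorTγ (y + fib (2 + i)) ≡ floorTγ y + fib i
floorTγ-shift i y 0<y y<F = begin-equality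
  floorTγ (y + fib (2 + i))    ≡⟨ floorTγ≡quo n (y + fib (2 + i)) (<⇒≤ y+J<R) ⟩
  quo (y + fib (2 + i))        ≡⟨ quo-shift i (2 + i) index y 0<y y<F ⟩
  quo y + fib i                ≡⟨ cong (_+ fib i) (sym (floorTγ≡quo n y (m+n≤o⇒m≤o y (<⇒≤ y+J<R)))) ⟩
  floorTγ y + fib i            ∎
  where
  n : ℕ
  n = 2 + i
  open Convergent (n + n)
  index : i + (2 + (2 + i)) ≡ n + n
  index = trans (+-suc i (3 + i)) (cong suc (+-suc i (2 + i)))
  y+J<R : y + fib (2 + i) < fib (1 + (n + n))
  y+J<R = <-≤-trans (+-monoˡ-< (fib (2 + i)) y<F)
                    (fib-mono (s≤s (s≤s (s≤s (≤-trans (n≤1+n (suc i)) (m≤n+m (2 + i) i))))))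

floorTγ-carry : ∀ x y → Σ ℕ λ e → e ≤ 1 × floorTγ (x + y) ≡ floorTγ x + floorTγ y + e
floorTγ-carry x y = subst₂ (λ a b → Σ ℕ λ e → e ≤ 1 × a ≡ b + e)
  (sym (floorTγ≡quo n (x + y) x+y≤R))
  (sym (cong₂ _+_ (floorTγ≡quo n x (≤-trans (m≤m+n x y) x+y≤R))
                  (floorTγ≡quo n y (≤-trans (m≤n+m y x) x+y≤R))))
  (quo-carry x y)
  where
  n : ℕ
  n = suc (x + y)
  open Convergent (n + n)
  x+y≤R : x + y ≤ fib (1 + (n + n))
  x+y≤R = ≤-trans (<⇒≤ (index<fib (x + y))) (fib-mono (s≤s (s≤s (m≤m+n (x + y) (suc (x + y))))))

sumTo-cong : ∀ m {g h : ℕ → ℕ} → (∀ k → k < m → g k ≡ h k) → sumTo m g ≡ sumTo m h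
sumTo-cong zero    eq = refl
sumTo-cong (suc m) eq = cong₂ _+_ (sumTo-cong m (λ k k<m → eq k (≤-trans k<m (n≤1+n m)))) (eq m ≤-refl)

sumTo-+ : ∀ m (g h : ℕ → ℕ) → sumTo m (λ k → g k + h k) ≡ sumTo m g + sumTo m h
sumTo-+ zero    g h = refl
sumTo-+ (suc m) g h = trans (cong (_+ (g m + h m)) (sumTo-+ m g h)) (swap (sumTo m g) (sumTo m h) (g m) (h m))
  where
  swap : ∀ a b c d → a + b + (c + d) ≡ a + c + (b + d)
  swap = solve-∀

sumTo-const : ∀ m c → sumTo m (λ _ → c) ≡ m * c
sumTo-const zero    c = refl
sumTo-const (suc m) c = trans (cong (_+ c) (sumTo-const m c)) (+-comm (m * c) c)

sumTo-split : ∀ a m (g : ℕ → ℕ) → sumTo (a + m) g ≡ sumTo a g + sumTo m (λ k → g (a + k))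
sumTo-split a zero    g = trans (cong (λ n → sumTo n g) (+-identityʳ a)) (sym (+-identityʳ _))
sumTo-split a (suc m) g = begin-equality
  sumTo (a + suc m) g                                         ≡⟨ cong (λ n → sumTo n g) (+-suc a m) ⟩
  sumTo (a + m) g + g (a + m)                                 ≡⟨ cong (_+ g (a + m)) (sumTo-split a m g) ⟩
  sumTo a g + sumTo m (λ k → g (a + k)) + g (a + m)           ≡⟨ +-assoc (sumTo a g) _ _ ⟩
  sumTo a g + (sumTo m (λ k → g (a + k)) + g (a + m))         ∎

floorSum : ℕ → ℕ
floorSum n = sumTo n (λ x → floorTγ (suc x))

floorTγ-≤-suc : ∀ n → floorTγ n ≤ floorTγ (suc n)
floorTγ-≤-suc n = ≤-trans (m≤m+n (floorTγ n) (floorTγ 1 + e))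
  (≤-reflexive (trans (sym (+-assoc (floorTγ n) (floorTγ 1) e)) (trans (sym eq) (cong floorTγ (+-comm n 1)))))
  where
  e : ℕ
  e = proj₁ (floorTγ-carry n 1)
  eq : floorTγ (n + 1) ≡ floorTγ n + floorTγ 1 + e
  eq = proj₂ (proj₂ (floorTγ-carry n 1))

fword-telescope : ∀ x n → sumTo n (λ ℓ → fword (x + ℓ)) + floorTγ (suc x) ≡ floorTγ (suc (x + n))
fword-telescope x zero    = cong (floorTγ ∘ suc) (sym (+-identityʳ x))
fword-telescope x (suc n) = begin-equality
  sumTo n f + fword (x + n) + floorTγ (suc x)         ≡⟨ +-comm-last (sumTo n f) (fword (x + n)) (floorTγ (suc x)) ⟩
  sumTo n f + floorTγ (suc x) + fword (x + n)         ≡⟨ cong (_+ fword (x + n)) (fword-telescope x n) ⟩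
  floorTγ (suc (x + n)) + fword (x + n)               ≡⟨ m+[n∸m]≡n (floorTγ-≤-suc (suc (x + n))) ⟩
  floorTγ (suc (suc (x + n)))                         ≡⟨ cong (floorTγ ∘ suc) (sym (+-suc x n)) ⟩
  floorTγ (suc (x + suc n))                           ∎
  where
  f : ℕ → ℕ
  f ℓ = fword (x + ℓ)
  +-comm-last : ∀ a b c → a + b + c ≡ a + c + b
  +-comm-last = solve-∀

T-as-floorSum : ∀ i m → T i m m + (floorSum (i + m) + floorSum (i + m)) ≡ floorSum (i + m + m) + floorSum i
T-as-floorSum i m = begin-equality
  T i m m + (floorSum (i + m) + floorSum (i + m))
    ≡⟨ cong (λ x → T i m m + (x + floorSum (i + m))) (sumTo-split i m _) ⟩
  T i m m + (floorSum i + Σ₁ + floorSum (i + m))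
    ≡⟨ regroup (T i m m) (floorSum i) Σ₁ (floorSum (i + m)) ⟩
  T i m m + Σ₁ + floorSum (i + m) + floorSum i
    ≡⟨ cong (λ x → x + floorSum (i + m) + floorSum i) rows ⟩
  Σ₂ + floorSum (i + m) + floorSum i
    ≡⟨ cong (_+ floorSum i) (trans (+-comm Σ₂ _) (sym (sumTo-split (i + m) m _))) ⟩
  floorSum (i + m + m) + floorSum i
    ∎
  where
  Σ₁ Σ₂ : ℕ
  Σ₁ = sumTo m (λ k → floorTγ (suc (i + k)))
  Σ₂ = sumTo m (λ k → floorTγ (suc (i + m + k)))
  regroup : ∀ t a b c → t + (a + b + c) ≡ t + b + c + a
  regroup = solve-∀
  row-shift : ∀ i k m → i + k + m ≡ i + m + k
  row-shift = solve-∀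
  rows : T i m m + Σ₁ ≡ Σ₂
  rows = trans (sym (sumTo-+ m _ _)) (sumTo-cong m (λ k _ →
           trans (fword-telescope (i + k) m) (cong (floorTγ ∘ suc) (row-shift i k m))))

floorSum-shift : ∀ i b → b < fib (3 + i) →
  floorSum (fib (2 + i) + b) ≡ floorSum (fib (2 + i)) + floorSum b + b * fib i
floorSum-shift i b b<F = begin-equality
  floorSum (J + b)                                         ≡⟨ sumTo-split J b _ ⟩
  floorSum J + sumTo b (λ k → floorTγ (suc (J + k)))       ≡⟨ cong (floorSum J +_) (sumTo-cong b shifted) ⟩
  floorSum J + sumTo b (λ k → floorTγ (suc k) + fib i)     ≡⟨ cong (floorSum J +_) (sumTo-+ b _ _) ⟩
  floorSum J + (floorSum b + sumTo b (λ _ → fib i))        ≡⟨ cong (λ x → floorSum J + (floorSum b + x))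
                                                                   (sumTo-const b (fib i)) ⟩
  floorSum J + (floorSum b + b * fib i)                    ≡⟨ sym (+-assoc (floorSum J) _ _) ⟩
  floorSum J + floorSum b + b * fib i                      ∎
  where
  J : ℕ
  J = fib (2 + i)
  shifted : ∀ k → k < b → floorTγ (suc (J + k)) ≡ floorTγ (suc k) + fib i
  shifted k k<b = trans (cong (floorTγ ∘ suc) (+-comm J k))
                        (floorTγ-shift i (suc k) (s≤s z≤n) (≤-<-trans k<b b<F))

cancel-combination : ∀ {x y a b : ℕ} → a ≡ b → x + b ≡ y + a → x ≡ y
cancel-combination {x} {y} {a} refl = +-cancelʳ-≡ a x y

T-step-algebra : ∀ {T₀ T₁ H H′ H″ u v w f e₁ e₂ : ℕ} →
  T₀ + (H′ + H′) ≡ H″ + H → T₁ + (H′ + v + (H′ + v)) ≡ H″ + w + (H + u) →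
  v ≡ u + f + e₁ → w ≡ v + f + e₂ → T₁ + e₁ ≡ T₀ + e₂
T-step-algebra {T₀} {T₁} {H} {H′} {H″} {u} {f = f} {e₁} {e₂} step₀ step₁ refl refl =
  cancel-combination (cong₂ _+_ step₁ (sym step₀))
    (solve (T₀ ∷ T₁ ∷ H ∷ H′ ∷ H″ ∷ u ∷ f ∷ e₁ ∷ e₂ ∷ []))

within-one : ∀ {x y e₁ e₂} → x + e₁ ≡ y + e₂ → e₁ ≤ 1 → e₂ ≤ 1 → x ≤ suc y × y ≤ suc x
within-one {x} {y} {e₁} {e₂} eq e₁≤1 e₂≤1 =
  ≤-trans (m≤m+n x e₁) (≤-trans (≤-reflexive eq) (≤-trans (+-monoʳ-≤ y e₂≤1) (≤-reflexive (+-comm y 1)))) ,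
  ≤-trans (m≤m+n y e₂) (≤-trans (≤-reflexive (sym eq)) (≤-trans (+-monoʳ-≤ x e₁≤1) (≤-reflexive (+-comm x 1))))

T-lipschitz : ∀ m i → T (suc i) m m ≤ suc (T i m m) × T i m m ≤ suc (T (suc i) m m)
T-lipschitz m i = within-one
  (T-step-algebra {T i m m} {T (suc i) m m} {floorSum i} {floorSum (i + m)} {floorSum (i + m + m)}
    {floorTγ (suc i)} {floorTγ (suc (i + m))} {floorTγ (suc (i + m + m))} {floorTγ m}
    (T-as-floorSum i m) (T-as-floorSum (suc i) m) (proj₂ (proj₂ carry₁)) (proj₂ (proj₂ carry₂)))
  (proj₁ (proj₂ carry₁)) (proj₁ (proj₂ carry₂))
  where
  carry₁ : Σ ℕ λ e → e ≤ 1 × floorTγ (suc i + m) ≡ floorTγ (suc i) + floorTγ m + e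
  carry₁ = floorTγ-carry (suc i) m
  carry₂ : Σ ℕ λ e → e ≤ 1 × floorTγ (suc (i + m) + m) ≡ floorTγ (suc (i + m)) + floorTγ m + e
  carry₂ = floorTγ-carry (suc (i + m)) m

window : ℕ → ℕ
window zero    = 0
window (suc k) = window k + fib (1 + 3 * k)

anchor : ℕ → ℕ
anchor zero    = 0
anchor (suc k) = anchor k + window (suc k)

window-double : ∀ k → window k + window k ≡ fib (3 * k)
window-double zero    = refl
window-double (suc k) = begin-equality
  window k + f + (window k + f)     ≡⟨ regroup (window k) f ⟩
  f + (window k + window k) + f     ≡⟨ cong (λ x → f + x + f) (window-double k) ⟩
  fib (3 + 3 * k)                   ≡⟨ cong fib (sym (*-suc 3 k)) ⟩
  fib (3 * suc k)                   ∎
  where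
  f : ℕ
  f = fib (1 + 3 * k)
  regroup : ∀ w f → w + f + (w + f) ≡ f + (w + w) + f
  regroup = solve-∀

window≡ : ∀ k → fib (3 * k) / 2 ≡ window k
window≡ k = /-unique (trans (sym (window-double k)) (double (window k))) (s≤s z≤n)
  where
  double : ∀ w → w + w ≡ 0 + w * 2
  double = solve-∀

anchor-fib : ∀ k → 4 * anchor k + 1 ≡ fib (2 + 3 * k)
anchor-fib zero    = refl
anchor-fib (suc k) = begin-equality
  4 * (anchor k + w) + 1             ≡⟨ regroup (anchor k) w ⟩
  4 * anchor k + 1 + 2 * (w + w)     ≡⟨ cong₂ (λ x y → x + 2 * y) (anchor-fib k) (window-double (suc k)) ⟩
  fib (2 + 3 * k) + 2 * fib (3 * suc k) ≡⟨ cong (λ j → fib (2 + 3 * k) + 2 * fib j) (*-suc 3 k) ⟩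
  fib (2 + 3 * k) + 2 * fib (3 + 3 * k) ≡⟨ fib-identity (fib (3 * k)) (fib (1 + 3 * k)) ⟩
  fib (5 + 3 * k)                   ≡⟨ cong (fib ∘ (2 +_)) (sym (*-suc 3 k)) ⟩
  fib (2 + 3 * suc k)               ∎
  where
  w : ℕ
  w = window (suc k)
  regroup : ∀ s w → 4 * (s + w) + 1 ≡ 4 * s + 1 + 2 * (w + w)
  regroup = solve-∀
  fib-identity : ∀ a b → b + a + 2 * (b + a + b) ≡ b + a + b + (b + a) + (b + a + b)
  fib-identity = solve-∀

triple-suc-suc : ∀ k → 3 * (2 + k) ≡ 6 + 3 * k
triple-suc-suc k = trans (*-suc 3 (suc k)) (cong (3 +_) (*-suc 3 k))

anchor-suc-suc : ∀ k → anchor (2 + k) ≡ fib (5 + 3 * k) + anchor k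
anchor-suc-suc k = *-cancelˡ-≡ _ _ 4 (+-cancelʳ-≡ 1 _ _ (begin-equality
  4 * anchor (2 + k) + 1                   ≡⟨ anchor-fib (2 + k) ⟩
  fib (2 + 3 * (2 + k))                   ≡⟨ cong (fib ∘ (2 +_)) (triple-suc-suc k) ⟩
  fib (8 + 3 * k)                         ≡⟨ fib-identity (fib (3 * k)) (fib (1 + 3 * k)) ⟩
  4 * fib (5 + 3 * k) + fib (2 + 3 * k)   ≡⟨ cong (4 * fib (5 + 3 * k) +_) (sym (anchor-fib k)) ⟩
  4 * fib (5 + 3 * k) + (4 * anchor k + 1) ≡⟨ regroup (fib (5 + 3 * k)) (anchor k) ⟩
  4 * (fib (5 + 3 * k) + anchor k) + 1     ∎))
  where
  fib-identity : ∀ a b →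
    let f₂ = b + a; f₃ = f₂ + b; f₄ = f₃ + f₂; f₅ = f₄ + f₃; f₆ = f₅ + f₄; f₇ = f₆ + f₅ in
    f₇ + f₆ ≡ 4 * f₅ + f₂
  fib-identity = solve-∀
  regroup : ∀ f s → 4 * f + (4 * s + 1) ≡ 4 * (f + s) + 1
  regroup = solve-∀

anchor<fib : ∀ k → anchor k < fib (1 + 3 * k)
anchor<fib k = *-cancelˡ-< 4 _ _ (begin
  suc (4 * anchor k)      ≡⟨ +-comm 1 (4 * anchor k) ⟩
  4 * anchor k + 1        ≡⟨ anchor-fib k ⟩
  f + fib (3 * k)         ≤⟨ +-monoʳ-≤ f (fib-≤-suc (3 * k)) ⟩
  f + f                   ≤⟨ m≤m+n (f + f) (f + f) ⟩
  f + f + (f + f)         ≡⟨ quadruple f ⟩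
  4 * f                   ∎)
  where
  f : ℕ
  f = fib (1 + 3 * k)
  quadruple : ∀ x → x + x + (x + x) ≡ 4 * x
  quadruple = solve-∀

+-window-twice : ∀ k a → a + window (suc k) + window (suc k) ≡ fib (3 + 3 * k) + a
+-window-twice k a = begin-equality
  a + window (suc k) + window (suc k)   ≡⟨ +-assoc a _ _ ⟩
  a + (window (suc k) + window (suc k)) ≡⟨ cong (a +_) (window-double (suc k)) ⟩
  a + fib (3 * suc k)                   ≡⟨ cong (λ j → a + fib j) (*-suc 3 k) ⟩
  a + fib (3 + 3 * k)                   ≡⟨ +-comm a _ ⟩
  fib (3 + 3 * k) + a                   ∎

module ClosedForms where
  open import Data.Integer using (ℤ; +_; -_)

  σ : ℕ → ℤ
  σ zero    = + 1
  σ (suc n) = - σ n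

  cassiniℤ : ∀ n → σ n ≡ + fib (1 + n) ℤ.* + fib (1 + n) ℤ.- + fib n ℤ.* + fib (2 + n)
  cassiniℤ zero    = refl
  cassiniℤ (suc n) = trans (cong -_ (cassiniℤ n)) (flip (+ fib n) (+ fib (suc n)))
    where
    flip : ∀ a b →
      - (b ℤ.* b ℤ.- a ℤ.* (b ℤ.+ a)) ≡ (b ℤ.+ a) ℤ.* (b ℤ.+ a) ℤ.- b ℤ.* (b ℤ.+ a ℤ.+ b)
    flip = ℤ-Ring.solve-∀

  linear-combination : ∀ {x y a b : ℤ} → a ≡ b → x ℤ.- y ≡ a ℤ.- b → x ≡ y
  linear-combination {x} {y} {a} refl e = ℤₚ.i-j≡0⇒i≡j x y (trans e (ℤₚ.+-inverseʳ a))

  floorSum-shiftℤ : ∀ i b → b < fib (3 + i) →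
    + floorSum (fib (2 + i) + b) ≡ + floorSum (fib (2 + i)) ℤ.+ + floorSum b ℤ.+ + b ℤ.* + fib i
  floorSum-shiftℤ i b b<F = trans (cong +_ (floorSum-shift i b b<F))
    (cong (λ z → + floorSum (fib (2 + i)) ℤ.+ + floorSum b ℤ.+ z) (ℤₚ.pos-* b (fib i)))

  anchor-fibℤ : ∀ k → + 4 ℤ.* + anchor k ℤ.+ + 1 ≡ + fib (2 + 3 * k)
  anchor-fibℤ k = trans (cong (λ z → z ℤ.+ + 1) (sym (ℤₚ.pos-* 4 (anchor k)))) (cong +_ (anchor-fib k))

  floorSum-fib-step : (a b s h₀ h₁ h₂ : ℤ) →
    let f₂ = b ℤ.+ a; f₃ = f₂ ℤ.+ b; f₄ = f₃ ℤ.+ f₂ in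
    s ≡ b ℤ.* b ℤ.- a ℤ.* f₂ →
    + 2 ℤ.* h₀ ≡ a ℤ.* f₂ ℤ.- b ℤ.+ s →
    + 2 ℤ.* h₁ ≡ b ℤ.* f₃ ℤ.- f₂ ℤ.+ - s →
    h₂ ≡ h₁ ℤ.+ h₀ ℤ.+ f₂ ℤ.* b →
    + 2 ℤ.* h₂ ≡ f₂ ℤ.* f₄ ℤ.- f₃ ℤ.+ - - s
  floorSum-fib-step a b s h₀ h₁ _ cassini′ e₀ e₁ refl =
    linear-combination (cong₂ ℤ._-_ (cong₂ ℤ._+_ e₀ e₁) cassini′)
      (ℤ-Ring.solve (a ∷ b ∷ s ∷ h₀ ∷ h₁ ∷ []))

  floorSum-fib : ∀ i →
    + 2 ℤ.* + floorSum (fib (2 + i)) ≡ + fib i ℤ.* + fib (2 + i) ℤ.- + fib (1 + i) ℤ.+ σ i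
  floorSum-fib zero          = refl
  floorSum-fib (suc zero)    = refl
  floorSum-fib (suc (suc i)) = floorSum-fib-step (+ fib i) (+ fib (1 + i)) (σ i)
    (+ floorSum (fib (2 + i))) (+ floorSum (fib (3 + i))) (+ floorSum (fib (4 + i)))
    (cassiniℤ i) (floorSum-fib i) (floorSum-fib (suc i))
    (floorSum-shiftℤ (suc i) (fib (2 + i)) (m<n+m (fib (2 + i)) (fib-pos (2 + i))))

  -- j stands for 3k; keeping it apart lets 3 * suc k be rewritten to 3 + 3 * k.
  anchor-formula : ℕ → ℕ → ℤ
  anchor-formula k j =
    + fib (1 + j) ℤ.* + fib (1 + j) ℤ.+ + 3 ℤ.- + 2 ℤ.* + fib (3 + j) ℤ.- + 4 ℤ.* + k ℤ.* σ j

  -- 32 h = 16 (2 hf) + 32 h₀ + 8 f₃ (4 g); what remains after inserting the hypotheses is −8 times Cassini's.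
  floorSum-anchor-step : (a b s κ h₀ hf h g : ℤ) →
    let f₂ = b ℤ.+ a; f₃ = f₂ ℤ.+ b; f₄ = f₃ ℤ.+ f₂; f₅ = f₄ ℤ.+ f₃
        f₆ = f₅ ℤ.+ f₄; f₇ = f₆ ℤ.+ f₅; f₈ = f₇ ℤ.+ f₆; f₉ = f₈ ℤ.+ f₇ in
    s ≡ b ℤ.* b ℤ.- a ℤ.* f₂ →
    + 32 ℤ.* h₀ ≡ b ℤ.* b ℤ.+ + 3 ℤ.- + 2 ℤ.* f₃ ℤ.- + 4 ℤ.* κ ℤ.* s →
    + 2 ℤ.* hf ≡ f₃ ℤ.* f₅ ℤ.- f₄ ℤ.+ - - - s →
    h ≡ hf ℤ.+ h₀ ℤ.+ g ℤ.* f₃ →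
    + 4 ℤ.* g ℤ.+ + 1 ≡ f₂ →
    + 32 ℤ.* h ≡ f₇ ℤ.* f₇ ℤ.+ + 3 ℤ.- + 2 ℤ.* f₉ ℤ.- + 4 ℤ.* (+ 2 ℤ.+ κ) ℤ.* - - - - - - s
  floorSum-anchor-step a b s κ h₀ hf _ g cassini′ e₀ e-hf refl e-g = linear-combination
    (cong₂ ℤ._-_ (cong₂ ℤ._+_ (cong₂ ℤ._+_ (cong (+ 16 ℤ.*_) e-hf) e₀)
                              (cong (+ 8 ℤ.* (b ℤ.+ a ℤ.+ b) ℤ.*_) e-g))
                 (cong (+ 8 ℤ.*_) cassini′))
    (ℤ-Ring.solve (a ∷ b ∷ s ∷ κ ∷ h₀ ∷ hf ∷ g ∷ []))

  floorSum-anchor : ∀ k → + 32 ℤ.* + floorSum (anchor k) ≡ anchor-formula k (3 * k)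
  floorSum-anchor zero          = refl
  floorSum-anchor (suc zero)    = refl
  floorSum-anchor (suc (suc k)) = subst (λ j → + 32 ℤ.* + floorSum (anchor (2 + k)) ≡ anchor-formula (2 + k) j)
    (sym (triple-suc-suc k))
    (floorSum-anchor-step (+ fib (3 * k)) (+ fib (1 + 3 * k)) (σ (3 * k)) (+ k)
      (+ floorSum (anchor k)) (+ floorSum (fib (5 + 3 * k))) (+ floorSum (anchor (2 + k))) (+ anchor k)
      (cassiniℤ (3 * k)) (floorSum-anchor k) (floorSum-fib (3 + 3 * k))
      (trans (cong (+_ ∘ floorSum) (anchor-suc-suc k)) (floorSum-shiftℤ (3 + 3 * k) (anchor k)
        (<-≤-trans (anchor<fib k) (fib-mono (s≤s (m≤n+m (3 * k) 5))))))
      (anchor-fibℤ k))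

  -- Eliminating x and y gives t₁ − t₀ = 4 s₁ − 4 s₀ − 2 hf + (g₁ − 3 g₀) b; after multiplying by 32 and
  -- inserting the closed forms, what remains is 16 times Cassini's identity.
  T-anchor-diff-algebra : (a b s κ t₀ t₁ s₀ s₁ hf x y g₀ g₁ : ℤ) →
    let f₂ = b ℤ.+ a; f₃ = f₂ ℤ.+ b; f₄ = f₃ ℤ.+ f₂; f₅ = f₄ ℤ.+ f₃; f₆ = f₅ ℤ.+ f₄ in
    s ≡ b ℤ.* b ℤ.- a ℤ.* f₂ →
    t₀ ℤ.+ (s₁ ℤ.+ s₁) ≡ x ℤ.+ s₀ →
    t₁ ℤ.+ (x ℤ.+ x) ≡ y ℤ.+ s₁ →
    x ≡ hf ℤ.+ s₀ ℤ.+ g₀ ℤ.* b →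
    y ≡ hf ℤ.+ s₁ ℤ.+ g₁ ℤ.* b →
    + 32 ℤ.* s₀ ≡ b ℤ.* b ℤ.+ + 3 ℤ.- + 2 ℤ.* f₃ ℤ.- + 4 ℤ.* κ ℤ.* s →
    + 32 ℤ.* s₁ ≡ f₄ ℤ.* f₄ ℤ.+ + 3 ℤ.- + 2 ℤ.* f₆ ℤ.- + 4 ℤ.* (+ 1 ℤ.+ κ) ℤ.* - - - s →
    + 2 ℤ.* hf ≡ b ℤ.* f₃ ℤ.- f₂ ℤ.+ - s →
    + 4 ℤ.* g₀ ℤ.+ + 1 ≡ f₂ →
    + 4 ℤ.* g₁ ℤ.+ + 1 ≡ f₅ →
    t₁ ≡ t₀ ℤ.+ s ℤ.* (+ 1 ℤ.+ κ)
  T-anchor-diff-algebra a b s κ t₀ t₁ s₀ s₁ hf _ _ g₀ g₁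
                        cassini′ e-t₀ e-t₁ refl refl e-s₀ e-s₁ e-hf e-g₀ e-g₁ =
    ℤₚ.*-cancelˡ-≡ (+ 32) _ _ (linear-combination
      (cong₂ ℤ._-_
        (cong₂ ℤ._+_ (cong₂ ℤ._+_ (cong₂ ℤ._+_ (cong (+ 32 ℤ.*_) e-t₁) (cong (+ 4 ℤ.*_) e-s₁))
                                 (cong (+ 8 ℤ.* b ℤ.*_) e-g₁)) (cong (+ 16 ℤ.*_) cassini′))
        (cong₂ ℤ._+_ (cong₂ ℤ._+_ (cong₂ ℤ._+_ (cong (+ 32 ℤ.*_) e-t₀) (cong (+ 4 ℤ.*_) e-s₀))
                                 (cong (+ 32 ℤ.*_) e-hf)) (cong (+ 24 ℤ.* b ℤ.*_) e-g₀)))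
      (ℤ-Ring.solve (a ∷ b ∷ s ∷ κ ∷ t₀ ∷ t₁ ∷ s₀ ∷ s₁ ∷ hf ∷ g₀ ∷ g₁ ∷ [])))

  T-anchor-diff : ∀ k → let m = window (suc k) in
    + T (anchor (suc k)) m m ≡ + T (anchor k) m m ℤ.+ σ (3 * k) ℤ.* + suc k
  T-anchor-diff k = T-anchor-diff-algebra (+ fib (3 * k)) (+ fib (1 + 3 * k)) (σ (3 * k)) (+ k)
    (+ T a₀ m m) (+ T a₁ m m) (+ floorSum a₀) (+ floorSum a₁) (+ floorSum J)
    (+ floorSum (J + a₀)) (+ floorSum (J + a₁)) (+ a₀) (+ a₁)
    (cassiniℤ (3 * k)) split₀ split₁
    (floorSum-shiftℤ (1 + 3 * k) a₀ (<-≤-trans (anchor<fib k) (fib-mono (m≤n+m (1 + 3 * k) 3))))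
    (floorSum-shiftℤ (1 + 3 * k) a₁ (subst (λ j → a₁ < fib (1 + j)) (*-suc 3 k) (anchor<fib (suc k))))
    (floorSum-anchor k)
    (subst (λ j → + 32 ℤ.* + floorSum a₁ ≡ anchor-formula (suc k) j) (*-suc 3 k) (floorSum-anchor (suc k)))
    (floorSum-fib (1 + 3 * k))
    (anchor-fibℤ k)
    (subst (λ j → + 4 ℤ.* + a₁ ℤ.+ + 1 ≡ + fib (2 + j)) (*-suc 3 k) (anchor-fibℤ (suc k)))
    where
    m a₀ a₁ J : ℕ
    m = window (suc k)
    a₀ = anchor k
    a₁ = anchor (suc k)
    J = fib (3 + 3 * k)
    split₀ : + T a₀ m m ℤ.+ (+ floorSum a₁ ℤ.+ + floorSum a₁) ≡ + floorSum (J + a₀) ℤ.+ + floorSum a₀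
    split₀ = cong +_ (trans (T-as-floorSum a₀ m) (cong (λ n → floorSum n + floorSum a₀) (+-window-twice k a₀)))
    split₁ : + T a₁ m m ℤ.+ (+ floorSum (J + a₀) ℤ.+ + floorSum (J + a₀))
           ≡ + floorSum (J + a₁) ℤ.+ + floorSum a₁
    split₁ = cong +_ (trans (cong (λ n → T a₁ m m + (floorSum n + floorSum n)) (sym (+-window-twice k a₀)))
               (trans (T-as-floorSum a₁ m) (cong (λ n → floorSum n + floorSum a₁) (+-window-twice k a₁))))

  σ-unit : ∀ n → σ n ≡ + 1 ⊎ σ n ≡ - + 1
  σ-unit zero    = inj₁ refl
  σ-unit (suc n) = [ (λ e → inj₂ (cong -_ e)) , (λ e → inj₁ (cong -_ e)) ]′ (σ-unit n)

  signed-gap : ∀ {x y d : ℕ} {s : ℤ} → + y ≡ + x ℤ.+ s ℤ.* + d → s ≡ + 1 ⊎ s ≡ - + 1 →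
               y ≡ x + d ⊎ x ≡ y + d
  signed-gap {x} {y} {d} e (inj₁ refl) =
    inj₁ (ℤₚ.+-injective (trans e (cong (λ z → + x ℤ.+ z) (ℤₚ.*-identityˡ (+ d)))))
  signed-gap {x} {y} {d} e (inj₂ refl) =
    inj₂ (ℤₚ.+-injective (trans (cancel (+ x) (+ d)) (cong (λ z → z ℤ.+ + d) (sym e))))
    where
    cancel : ∀ X D → X ≡ X ℤ.+ (- + 1) ℤ.* D ℤ.+ D
    cancel = ℤ-Ring.solve-∀

  T-anchor-gap : ∀ k → let m = window (suc k) in
    T (anchor (suc k)) m m ≡ T (anchor k) m m + suc k ⊎ T (anchor k) m m ≡ T (anchor (suc k)) m m + suc k
  T-anchor-gap k = signed-gap (T-anchor-diff k) (σ-unit (3 * k))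

open ClosedForms using (T-anchor-gap)

ivt-up : ∀ (h : ℕ → ℕ) → (∀ i → h (suc i) ≤ suc (h i)) →
  ∀ a d v → h a ≤ v → v ≤ h (a + d) → Σ ℕ λ i → h i ≡ v
ivt-up h step a zero    v lo hi = a , ≤-antisym lo (subst (λ x → v ≤ h x) (+-identityʳ a) hi)
ivt-up h step a (suc d) v lo hi with v ≤? h (a + d)
... | yes v≤ = ivt-up h step a d v lo v≤
... | no  v≰ = a + suc d , ≤-antisym (≤-trans (subst (λ x → h x ≤ suc (h (a + d))) (sym (+-suc a d)) (step (a + d)))
                                               (≰⇒> v≰)) hi

ivt-down : ∀ (h : ℕ → ℕ) → (∀ i → h i ≤ suc (h (suc i))) →
  ∀ a d v → v ≤ h a → h (a + d) ≤ v → Σ ℕ λ i → h i ≡ v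
ivt-down h step a zero    v hi lo = a , ≤-antisym (subst (λ x → h x ≤ v) (+-identityʳ a) lo) hi
ivt-down h step a (suc d) v hi lo with h (a + d) ≤? v
... | yes ≤v = ivt-down h step a d v hi ≤v
... | no  ≰v = a + suc d , ≤-antisym lo (≤-pred (≤-trans (≰⇒> ≰v)
                 (subst (λ x → h (a + d) ≤ suc (h x)) (sym (+-suc a d)) (step (a + d)))))

injective-on-values : ∀ (h : ℕ → ℕ) lo d → (∀ j → j ≤ d → Σ ℕ λ i → h i ≡ lo + j) →
  Σ (Fin (suc d) → ℕ) λ g → Injective _≡_ _≡_ (h ∘ g)
injective-on-values h lo d attained = g , injective
  where
  witness : (j : Fin (suc d)) → Σ ℕ λ i → h i ≡ lo + toℕ j
  witness j = attained (toℕ j) (≤-pred (toℕ<n j))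
  g : Fin (suc d) → ℕ
  g j = proj₁ (witness j)
  injective : Injective _≡_ _≡_ (h ∘ g)
  injective {j} {j′} eq = toℕ-injective (+-cancelˡ-≡ lo _ _
    (trans (sym (proj₂ (witness j))) (trans eq (proj₂ (witness j′)))))

distinct-values-rising : ∀ (h : ℕ → ℕ) → (∀ i → h (suc i) ≤ suc (h i)) →
  ∀ a m d → h (a + m) ≡ h a + d → Σ (Fin (suc d) → ℕ) λ g → Injective _≡_ _≡_ (h ∘ g)
distinct-values-rising h step a m d gap = injective-on-values h (h a) d λ j j≤d →
  ivt-up h step a m (h a + j) (m≤m+n (h a) j) (subst (h a + j ≤_) (sym gap) (+-monoʳ-≤ (h a) j≤d))

distinct-values-falling : ∀ (h : ℕ → ℕ) → (∀ i → h i ≤ suc (h (suc i))) →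
  ∀ a m d → h a ≡ h (a + m) + d → Σ (Fin (suc d) → ℕ) λ g → Injective _≡_ _≡_ (h ∘ g)
distinct-values-falling h step a m d gap = injective-on-values h (h (a + m)) d λ j j≤d →
  ivt-down h step a m (h (a + m) + j) (subst (h (a + m) + j ≤_) (sym gap) (+-monoʳ-≤ (h (a + m)) j≤d))
    (m≤m+n (h (a + m)) j)

theorem8 : (k : ℕ) → 1 ≤ k →
    Σ (Fin (suc k) → ℕ) (λ g →
      Injective _≡_ _≡_ (λ j → T (g j) (fib (3 * k) / 2) (fib (3 * k) / 2)))
theorem8 (suc k) _ = subst (λ n → Σ (Fin (2 + k) → ℕ) λ g → Injective _≡_ _≡_ (λ j → T (g j) n n))
  (sym (window≡ (suc k)))
  ([ distinct-values-rising h (proj₁ ∘ T-lipschitz m) (anchor k) m (suc k)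
   , distinct-values-falling h (proj₂ ∘ T-lipschitz m) (anchor k) m (suc k)
   ]′ (T-anchor-gap k))
  where
  m : ℕ
  m = window (suc k)
  h : ℕ → ℕ
  h i = T i m m
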